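{- Let $n,m\ge 0$ and let $A\subseteq Y_n$, $B\subseteq Y_m$ be groves. Then the sets $a+b$, for $(a,b)\in A\times B$, are pairwise disjoint subsets of $Y_{n+m}$. Consequently $A+B$ is again a grove (each tree occurs in it at most once), and addition defines a map $+:\mathbb{Y}_n\times\mathbb{Y}_m\to\mathbb{Y}_{n+m}$.
   Context: A planar binary tree of degree $n\ge 0$ is a planar rooted tree (up to planar isotopy) with $n+1$ leaves in which every internal vertex has exactly two inputs; $Y_n$ is the set of these trees. $Y_0=\{|\}$ (the single edge, also denoted $0$). For $x\in Y_p$, $y\in Y_q$ the grafting $x\vee y\in Y_{p+q+1}$ joins the roots of $x$ and $y$ to a new vertex with a new root; every $x\in Y_n$, $n\ge1$, decomposes uniquely as $x=x^l\vee x^r$. Each $Y_n$ carries the (Tamari) partial order: the smallest partial order such that $(a\vee b)\vee c\le a\vee(b\vee c)$ for all trees $a,b,c$, and $a\le b$ implies $a\vee c\le b\vee c$ and $c\vee a\le c\vee b$. For $x\in Y_p,y\in Y_q$, the tree $x/y\in Y_{p+q}$ ("over") is obtained by identifying the root of $x$ with the leftmost leaf of $y$, and $x\backslash y\in Y_{p+q}$ ("under") by identifying the rightmost leaf of $x$ with the root of $y$ (recursively: $x/|=x$, $x/(y^l\vee y^r)=(x/y^l)\vee y^r$, $|\backslash y=y$, $(x^l\vee x^r)\backslash y=x^l\vee(x^r\backslash y)$). The sum of trees is $x+y:=\{z\in Y_{p+q}: x/y\le z\le x\backslash y\}$. A grove of degree $n$ is a nonempty subset of $Y_n$; $\mathbb{Y}_n$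 denotes the set of groves of degree $n$. For groves $A,B$ (a tree being identified with a one-element grove), $A+B$ is defined as the union of the sets $a+b$, $a\in A$, $b\in B$, a priori counted with multiplicity (multiset union). -}

module Defs where

open import Data.Nat using (ℕ; zero; suc; _+_)
open import Data.Product using (Σ; ∃; _×_; _,_)
open import Relation.Binary.PropositionalEquality using (_≡_)

data Tree : Set where
  leaf : Tree
  _∨_  : Tree → Tree → Tree

infixr 5 _∨_

-- degree = number of internal vertices (= number of leaves - 1)
deg : Tree → ℕ
deg leaf    = 0
deg (l ∨ r) = suc (deg l + deg r)

Y : ℕ → Tree → Set
Y n t = deg t ≡ n

data _≤T_ : Tree → Tree → Set where
  ≤-assoc : ∀ a b c → ((a ∨ b) ∨ c) ≤T (a ∨ (b ∨ c))
  ≤-left  : ∀ {a b} c → a ≤T b → (a ∨ c) ≤T (b ∨ c)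
  ≤-right : ∀ {a b} c → a ≤T b → (c ∨ a) ≤T (c ∨ b)
  ≤-refl  : ∀ a → a ≤T a
  ≤-trans : ∀ {a b c} → a ≤T b → b ≤T c → a ≤T c

-- over: root of x identified with leftmost leaf of y
_/_ : Tree → Tree → Tree
x / leaf    = x
x / (l ∨ r) = (x / l) ∨ r

-- under: rightmost leaf of x identified with root of y
_\\_ : Tree → Tree → Tree
leaf    \\ y = y
(l ∨ r) \\ y = l ∨ (r \\ y)

_∈Sum_,_ : Tree → Tree → Tree → Set
z ∈Sum x , y = Y (deg x + deg y) z × ((x / y) ≤T z) × (z ≤T (x \\ y))

record Grove (n : ℕ) : Set₁ where
  field
    mem      : Tree → Set
    mem-deg  : ∀ t → mem t → Y n t
    nonempty : Σ Tree mem
open Grove public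

-- z ∈ A + B  (support of the multiset union of the sets a + b)
_∈GroveSum_,_ : ∀ {n m} → Tree → Grove n → Grove m → Set
z ∈GroveSum A , B = Σ Tree λ a → Σ Tree λ b → mem A a × mem B b × (z ∈Sum a , b)

-- Encode a tree by the sizes of the left subtrees of its internal vertices, read in
-- in-order. This encoding is injective, antitone for the Tamari order (pointwise), and
-- both x / y and x \\ y extend the code of x. Hence every z with x / y ≤ z ≤ x \\ y has
-- the code of x as a prefix, so z and deg x determine x. Mirroring the trees exchanges
-- / with \\ and reverses the order, so the same argument recovers y.
module Submission where

open import Defs
open import Data.Nat using (ℕ; suc; pred; _+_; _≤_; _≥_; _<_; s≤s)
open import Data.Nat.Properties
  using (+-suc; +-assoc; +-comm; +-identityʳ; ≤-antisym; m≤m+n; m≤n+m; <-cmp; <⇒≤; <⇒≢; 1+n≰n; 0≢1+n)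
  renaming (≤-refl to ≤ℕ-refl; ≤-trans to ≤ℕ-trans)
open import Data.List using (List; []; _∷_; _++_; length)
open import Data.List.Properties
  using (++-assoc; ++-identityʳ; ++-cancelˡ; length-++; ∷-injective; ∷-injectiveʳ)
open import Data.List.Relation.Binary.Pointwise as Pointwise using (Pointwise; _∷_)
open import Data.Product using (Σ; ∃-syntax; _×_; _,_; proj₁)
open import Data.Unit using (⊤; tt)
open import Data.Empty using (⊥-elim)
open import Relation.Binary.Definitions using (tri<; tri≈; tri>)
open import Relation.Binary.PropositionalEquality
  using (_≡_; _≢_; refl; sym; trans; cong; cong₂; subst; subst₂)

private
  variable
    a b z : Tree

++-prefix-≤ : ∀ (xs xs' : List ℕ) {ys ys'} → xs ++ ys ≡ xs' ++ ys' → length xs ≤ length xs' →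
              ∃[ u ] (xs' ≡ xs ++ u × ys ≡ u ++ ys')
++-prefix-≤ []       xs'        e _       = xs' , refl , e
++-prefix-≤ (x ∷ xs) (x' ∷ xs') e (s≤s p) with ∷-injective e
... | refl , e′ with ++-prefix-≤ xs xs' e′ p
...   | u , refl , eys = u , refl , eys

++-cancel-length : ∀ (xs xs' : List ℕ) {ys ys'} → length xs ≡ length xs' →
                   xs ++ ys ≡ xs' ++ ys' → xs ≡ xs'
++-cancel-length []       []         _ _ = refl
++-cancel-length (x ∷ xs) (x' ∷ xs') l e with ∷-injective e
... | refl , e′ = cong (x ∷_) (++-cancel-length xs xs' (cong pred l) e′)

_≥*_ : List ℕ → List ℕ → Set
_≥*_ = Pointwise _≥_

≥*-refl : ∀ {xs} → xs ≥* xs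
≥*-refl = Pointwise.refl ≤ℕ-refl

≥*-trans : ∀ {xs ys zs} → xs ≥* ys → ys ≥* zs → xs ≥* zs
≥*-trans = Pointwise.transitive (λ p q → ≤ℕ-trans q p)

≥*-squeeze-prefix : ∀ p {w₁ w₂ zs} → (p ++ w₁) ≥* zs → zs ≥* (p ++ w₂) → ∃[ w ] zs ≡ p ++ w
≥*-squeeze-prefix []      {zs = zs} _ _ = zs , refl
≥*-squeeze-prefix (i ∷ p) (i≥j ∷ P) (j≥i ∷ Q) with ≥*-squeeze-prefix p P Q
... | w , refl rewrite ≤-antisym j≥i i≥j = w , refl

Bounded : ℕ → List ℕ → Set
Bounded i []       = ⊤
Bounded i (x ∷ xs) = x ≤ i × Bounded (suc i) xs

Bounded-++ : ∀ {i} xs {ys} → Bounded i xs → Bounded (length xs + i) ys → Bounded i (xs ++ ys)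
Bounded-++ []                 _          B = B
Bounded-++ {i} (x ∷ xs) {ys} (x≤i , A) B =
  x≤i , Bounded-++ xs A (subst (λ j → Bounded j ys) (sym (+-suc (length xs) i)) B)

Bounded-middle : ∀ {i} u {x v} → Bounded i (u ++ x ∷ v) → x ≤ length u + i
Bounded-middle     []      (x≤i , _) = x≤i
Bounded-middle {i} (_ ∷ u) {x} (_ , B) = subst (x ≤_) (+-suc (length u) i) (Bounded-middle u B)

deg-over : ∀ x y → deg (x / y) ≡ deg x + deg y
deg-over x leaf    = sym (+-identityʳ (deg x))
deg-over x (u ∨ v) rewrite deg-over x u | +-assoc (deg x) (deg u) (deg v) =
  sym (+-suc (deg x) (deg u + deg v))

≤T⇒deg≡ : a ≤T b → deg a ≡ deg b
≤T⇒deg≡ (≤-assoc a b c) rewrite +-assoc (deg a) (deg b) (deg c) =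
  cong suc (sym (+-suc (deg a) (deg b + deg c)))
≤T⇒deg≡ (≤-left c p)    = cong (λ d → suc (d + deg c)) (≤T⇒deg≡ p)
≤T⇒deg≡ (≤-right c p)   = cong (λ d → suc (deg c + d)) (≤T⇒deg≡ p)
≤T⇒deg≡ (≤-refl a)      = refl
≤T⇒deg≡ (≤-trans p q)   = trans (≤T⇒deg≡ p) (≤T⇒deg≡ q)

under-leaf : ∀ x → x \\ leaf ≡ x
under-leaf leaf    = refl
under-leaf (l ∨ r) = cong (l ∨_) (under-leaf r)

under-∨-≤T : ∀ x u v → ((x \\ u) ∨ v) ≤T (x \\ (u ∨ v))
under-∨-≤T leaf    u v = ≤-refl _
under-∨-≤T (l ∨ r) u v = ≤-trans (≤-assoc l (r \\ u) v) (≤-right l (under-∨-≤T r u v))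

over≤under : ∀ x y → (x / y) ≤T (x \\ y)
over≤under x leaf    = subst ((x / leaf) ≤T_) (sym (under-leaf x)) (≤-refl x)
over≤under x (u ∨ v) = ≤-trans (≤-left v (over≤under x u)) (under-∨-≤T x u v)

mirror : Tree → Tree
mirror leaf    = leaf
mirror (l ∨ r) = mirror r ∨ mirror l

mirror-involutive : ∀ t → mirror (mirror t) ≡ t
mirror-involutive leaf    = refl
mirror-involutive (l ∨ r) = cong₂ _∨_ (mirror-involutive l) (mirror-involutive r)

mirror-injective : mirror a ≡ mirror b → a ≡ b
mirror-injective {a} {b} e = trans (sym (mirror-involutive a)) (trans (cong mirror e) (mirror-involutive b))

deg-mirror : ∀ t → deg (mirror t) ≡ deg t
deg-mirror leaf    = refl
deg-mirror (l ∨ r) rewrite deg-mirror l | deg-mirror r = cong suc (+-comm (deg r) (deg l))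

mirror-over : ∀ x y → mirror (x / y) ≡ mirror y \\ mirror x
mirror-over x leaf    = refl
mirror-over x (u ∨ v) = cong (mirror v ∨_) (mirror-over x u)

mirror-under : ∀ x y → mirror (x \\ y) ≡ mirror y / mirror x
mirror-under leaf    y = refl
mirror-under (l ∨ r) y = cong (_∨ mirror l) (mirror-under r y)

mirror-antitone : a ≤T b → mirror b ≤T mirror a
mirror-antitone (≤-assoc a b c) = ≤-assoc (mirror c) (mirror b) (mirror a)
mirror-antitone (≤-left c p)    = ≤-right (mirror c) (mirror-antitone p)
mirror-antitone (≤-right c p)   = ≤-left (mirror c) (mirror-antitone p)
mirror-antitone (≤-refl a)      = ≤-refl _
mirror-antitone (≤-trans p q)   = ≤-trans (mirror-antitone q) (mirror-antitone p)

mirror-∈Sum : ∀ {x y z} → z ∈Sum x , y → mirror z ∈Sum mirror y , mirror x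
mirror-∈Sum {x} {y} {z} (z∈Y , p , q) =
  trans (deg-mirror z) (trans z∈Y (trans (+-comm (deg x) (deg y))
    (sym (cong₂ _+_ (deg-mirror y) (deg-mirror x))))) ,
  subst (_≤T mirror z) (mirror-under x y) (mirror-antitone q) ,
  subst (mirror z ≤T_) (mirror-over x y) (mirror-antitone p)

leftSizes : Tree → List ℕ
leftSizes leaf    = []
leftSizes (l ∨ r) = leftSizes l ++ deg l ∷ leftSizes r

length-leftSizes : ∀ t → length (leftSizes t) ≡ deg t
length-leftSizes leaf    = refl
length-leftSizes (l ∨ r) rewrite length-++ (leftSizes l) {deg l ∷ leftSizes r}
                               | length-leftSizes l | length-leftSizes r = +-suc (deg l) (deg r)

leftSizes-antitone : a ≤T b → leftSizes a ≥* leftSizes b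
leftSizes-antitone (≤-assoc a b c)
  rewrite ++-assoc (leftSizes a) (deg a ∷ leftSizes b) (suc (deg a + deg b) ∷ leftSizes c) =
  Pointwise.++⁺ ≥*-refl (≤ℕ-refl ∷ Pointwise.++⁺ ≥*-refl (m≤n+m (deg b) (suc (deg a)) ∷ ≥*-refl))
leftSizes-antitone (≤-left c p) rewrite ≤T⇒deg≡ p = Pointwise.++⁺ (leftSizes-antitone p) ≥*-refl
leftSizes-antitone (≤-right c p) = Pointwise.++⁺ ≥*-refl (≤ℕ-refl ∷ leftSizes-antitone p)
leftSizes-antitone (≤-refl a)    = ≥*-refl
leftSizes-antitone (≤-trans p q) = ≥*-trans (leftSizes-antitone p) (leftSizes-antitone q)

leftSizes-over : ∀ x y → ∃[ w ] leftSizes (x / y) ≡ leftSizes x ++ w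
leftSizes-over x leaf = [] , sym (++-identityʳ (leftSizes x))
leftSizes-over x (u ∨ v) with leftSizes-over x u
... | w , e rewrite e = w ++ deg (x / u) ∷ leftSizes v , ++-assoc (leftSizes x) w _

leftSizes-under : ∀ x y → ∃[ w ] leftSizes (x \\ y) ≡ leftSizes x ++ w
leftSizes-under leaf    y = leftSizes y , refl
leftSizes-under (l ∨ r) y with leftSizes-under r y
... | w , e rewrite e = w , sym (++-assoc (leftSizes l) (deg l ∷ leftSizes r) w)

leftSizes-bounded : ∀ i t → Bounded i (leftSizes t)
leftSizes-bounded i leaf    = tt
leftSizes-bounded i (l ∨ r) =
  Bounded-++ (leftSizes l) (leftSizes-bounded i l)
    (subst (λ d → Bounded (d + i) (deg l ∷ leftSizes r)) (sym (length-leftSizes l))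
      (m≤m+n (deg l) i , leftSizes-bounded (suc (deg l + i)) r))

-- The root of l ∨ r sits at position deg l, the last position k whose entry equals k.
leftSizes-root : ∀ {l r l' r'} → deg l < deg l' → leftSizes (l ∨ r) ≢ leftSizes (l' ∨ r')
leftSizes-root {l} {r} {l'} {r'} l<l' e
  with ++-prefix-≤ (leftSizes l) (leftSizes l') e
         (subst₂ _≤_ (sym (length-leftSizes l)) (sym (length-leftSizes l')) (<⇒≤ l<l'))
... | []    , _   , e-root = <⇒≢ l<l' (proj₁ (∷-injective e-root))
... | _ ∷ u , e-l , e-root = 1+n≰n (≤ℕ-trans 1+u≤deg-l' deg-l'≤u)
  where
  1+u≤deg-l' : suc (length u) ≤ deg l'
  1+u≤deg-l' = subst (suc (length u) ≤_)
    (trans (sym (length-++ (leftSizes l))) (trans (cong length (sym e-l)) (length-leftSizes l')))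
    (m≤n+m (suc (length u)) (length (leftSizes l)))
  deg-l'≤u : deg l' ≤ length u
  deg-l'≤u = subst (deg l' ≤_) (+-identityʳ (length u))
    (Bounded-middle u (subst (Bounded 0) (∷-injectiveʳ e-root) (leftSizes-bounded 0 r)))

leftSizes-injective : ∀ s t → leftSizes s ≡ leftSizes t → s ≡ t
leftSizes-injective leaf    leaf    _ = refl
leftSizes-injective leaf    (l ∨ r) e = ⊥-elim (0≢1+n (trans (cong length e) (length-leftSizes (l ∨ r))))
leftSizes-injective (l ∨ r) leaf    e = ⊥-elim (0≢1+n (trans (cong length (sym e)) (length-leftSizes (l ∨ r))))
leftSizes-injective (l ∨ r) (l' ∨ r') e with <-cmp (deg l) (deg l')
... | tri< l<l' _ _ = ⊥-elim (leftSizes-root {l} {r} {l'} {r'} l<l' e)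
... | tri> _ _ l>l' = ⊥-elim (leftSizes-root {l'} {r'} {l} {r} l>l' (sym e))
... | tri≈ _ l≡l' _ = cong₂ _∨_ (leftSizes-injective l l' e-l) (leftSizes-injective r r' e-r)
  where
  e-l : leftSizes l ≡ leftSizes l'
  e-l = ++-cancel-length (leftSizes l) (leftSizes l')
          (trans (length-leftSizes l) (trans l≡l' (sym (length-leftSizes l')))) e
  e-r : leftSizes r ≡ leftSizes r'
  e-r = ∷-injectiveʳ (++-cancelˡ (leftSizes l) (deg l ∷ leftSizes r) (deg l' ∷ leftSizes r')
          (trans e (cong (_++ _) (sym e-l))))

leftSizes-∈Sum : ∀ {x y z} → z ∈Sum x , y → ∃[ w ] leftSizes z ≡ leftSizes x ++ w
leftSizes-∈Sum {x} {y} {z} (_ , p , q) with leftSizes-over x y | leftSizes-under x y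
... | w₁ , e₁ | w₂ , e₂ = ≥*-squeeze-prefix (leftSizes x)
  (subst (_≥* leftSizes z) e₁ (leftSizes-antitone p))
  (subst (leftSizes z ≥*_) e₂ (leftSizes-antitone q))

∈Sum-left-unique : ∀ {x y x' y' z} → deg x ≡ deg x' → z ∈Sum x , y → z ∈Sum x' , y' → x ≡ x'
∈Sum-left-unique {x} {y} {x'} {y'} d z∈x+y z∈x'+y'
  with leftSizes-∈Sum {x} {y} z∈x+y | leftSizes-∈Sum {x'} {y'} z∈x'+y'
... | w , e | w' , e' = leftSizes-injective x x'
  (++-cancel-length (leftSizes x) (leftSizes x')
    (trans (length-leftSizes x) (trans d (sym (length-leftSizes x')))) (trans (sym e) e'))

∈Sum-right-unique : ∀ {x y x' y' z} → deg y ≡ deg y' → z ∈Sum x , y → z ∈Sum x' , y' → y ≡ y'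
∈Sum-right-unique {x} {y} {x'} {y'} d z∈x+y z∈x'+y' = mirror-injective (∈Sum-left-unique
  {mirror y} {mirror x} {mirror y'} {mirror x'}
  (trans (deg-mirror y) (trans d (sym (deg-mirror y'))))
  (mirror-∈Sum {x} {y} z∈x+y) (mirror-∈Sum {x'} {y'} z∈x'+y'))

over∈Sum : ∀ x y → (x / y) ∈Sum x , y
over∈Sum x y = deg-over x y , ≤-refl (x / y) , over≤under x y

∈Sum-deg : ∀ {n m} → Y n a → Y m b → z ∈Sum a , b → Y (n + m) z
∈Sum-deg refl refl (z∈Y , _) = z∈Y

∈Sum-disjoint : ∀ {a a' b b'} → deg a ≡ deg a' → deg b ≡ deg b' →
                z ∈Sum a , b → z ∈Sum a' , b' → a ≡ a' × b ≡ b'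
∈Sum-disjoint da db z∈a+b z∈a'+b' =
  ∈Sum-left-unique da z∈a+b z∈a'+b' , ∈Sum-right-unique db z∈a+b z∈a'+b'

_⊕_ : ∀ {n m} → Grove n → Grove m → Grove (n + m)
A ⊕ B = record
  { mem      = _∈GroveSum A , B
  ; mem-deg  = λ { z (a , b , a∈A , b∈B , z∈a+b) → ∈Sum-deg (mem-deg A a a∈A) (mem-deg B b b∈B) z∈a+b }
  ; nonempty = nonempty-sum (nonempty A) (nonempty B)
  }
  where
  nonempty-sum : Σ Tree (mem A) → Σ Tree (mem B) → Σ Tree (_∈GroveSum A , B)
  nonempty-sum (a , a∈A) (b , b∈B) = a / b , a , b , a∈A , b∈B , over∈Sum a b

theorem2p2 : (n m : ℕ) (A : Grove n) (B : Grove m) →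
    -- the sets a + b, (a , b) ∈ A × B, are pairwise disjoint
    (∀ a a' b b' z → mem A a → mem A a' → mem B b → mem B b' →
      z ∈Sum a , b → z ∈Sum a' , b' → (a ≡ a') × (b ≡ b'))
    -- they are subsets of Y (n + m)
    × (∀ a b z → mem A a → mem B b → z ∈Sum a , b → Y (n + m) z)
    -- A + B is a grove of degree n + m: nonempty, contained in Y (n + m)
    × Σ (Grove (n + m)) (λ C → ∀ z → (mem C z → z ∈GroveSum A , B) × (z ∈GroveSum A , B → mem C z))
theorem2p2 n m A B =
  (λ a a' b b' z a∈A a'∈A b∈B b'∈B →
    ∈Sum-disjoint (same-deg A a∈A a'∈A) (same-deg B b∈B b'∈B)) ,
  (λ a b z a∈A b∈B → ∈Sum-deg (mem-deg A a a∈A) (mem-deg B b b∈B)) ,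
  A ⊕ B , λ z → (λ z∈C → z∈C) , (λ z∈C → z∈C)
  where
  same-deg : ∀ {k} (G : Grove k) {t t'} → mem G t → mem G t' → deg t ≡ deg t'
  same-deg G {t} {t'} t∈G t'∈G = trans (mem-deg G t t∈G) (sym (mem-deg G t' t'∈G))
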